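{- For each integer $b\ge1$, let $L_b^{\mathrm{box}}=\{w\in\{0,1\}^*\mid |w|_0=|w|_1=2b,\ \forall k\in\{1,\dots,b\}:\ \delta_{k,k}^{2b}(w)\in\{0101,1010,0110,1001\}\}$. Then $L_b^{\mathrm{box}}$ is $2b$-uniform and $\mathcal{G}_{L_b^{\mathrm{box}}}$ is exactly the class of graphs of boxicity at most $b$.
   Context: $|w|_a$ is the number of occurrences of letter $a$ in $w$; a binary word is $k$-uniform if it has exactly $k$ occurrences of $0$ and of $1$. For a $2b$-uniform binary word $w$ and $k\in\{1,\dots,b\}$, $\delta_{k,k}^{2b}(w)$ is obtained from $w$ by deleting all occurrences of $0$ except the $(2k-1)$-st and $2k$-th, and all occurrences of $1$ except the $(2k-1)$-st and $2k$-th. For a word $w$ and distinct letters $a,b$, $h_{a,b}(w)$ replaces $a$ by $0$, $b$ by $1$ and deletes other letters. For $L\subseteq\{0,1\}^*$ closed under exchanging $0$ and $1$ and a word $w$ with letter set $V$, $G(L,w)$ is the graph on $V$ where distinct $u,v$ are adjacent iff $h_{u,v}(w)\in L$; $\mathcal{G}_L$ is the class of graphs isomorphic to some $G(L,w)$. A graph has boxicity at most $b$ if it is the intersection graph of a family of axis-parallel boxes $[\ell_1,r_1]\times\dots\times[\ell_b,r_b]$ in $\mathbb{R}^b$ (one per vertex, adjacency iff the boxes intersect).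
   Formalization: The boxes defining boxicity at most $b$ have rational endpoints rather than real ones. -}

module Defs where

open import Data.Bool using (Bool; true; false)
open import Data.Nat using (ℕ; zero; suc; _+_; _*_; _≥_)
open import Data.Fin using (Fin; _≟_)
open import Data.List using (List; []; _∷_; length; filter)
open import Data.List.Relation.Unary.Any using (Any)
open import Data.Product using (Σ; _×_; _,_; ∃)
open import Data.Sum using (_⊎_)
open import Data.Rational using (ℚ; _≤_)
open import Relation.Binary.PropositionalEquality using (_≡_; _≢_)
open import Relation.Nullary using (yes; no)
import Data.Empty
open import Function.Bundles using (_⇔_; _↔_; Inverse)

-- Binary words: 0 is represented by false, 1 by true.
Word : Set
Word = List Bool

count : Bool → Word → ℕ
count false []          = 0
count false (false ∷ w) = suc (count false w)
count false (true ∷ w)  = count false w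
count true  []          = 0
count true  (true ∷ w)  = suc (count true w)
count true  (false ∷ w) = count true w

Language : Set₁
Language = Word → Set

Uniform : ℕ → Language → Set
Uniform k L = ∀ w → L w → count false w ≡ k × count true w ≡ k

-- Helper for δ: i0 / i1 = number of 0s / 1s already read (so the current
-- 0 is the (i0+1)-st occurrence). Keep the occurrences with 1-based index
-- 2k-1 or 2k, i.e. 0-based index 2k-2 or 2k-1; with k = suc j these are
-- 2j and 2j+1.
keepIdx : ℕ → ℕ → Bool
keepIdx j i with i Data.Nat.≟ (2 * j) | i Data.Nat.≟ (suc (2 * j))
... | yes _ | _     = true
... | no _  | yes _ = true
... | no _  | no _  = false

δgo : ℕ → ℕ → ℕ → Word → Word
δgo j i0 i1 []          = []
δgo j i0 i1 (false ∷ w) with keepIdx j i0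
... | true  = false ∷ δgo j (suc i0) i1 w
... | false = δgo j (suc i0) i1 w
δgo j i0 i1 (true ∷ w) with keepIdx j i1
... | true  = true ∷ δgo j i0 (suc i1) w
... | false = δgo j i0 (suc i1) w

-- δ^{2b}_{k,k}(w) for k = suc j (k ≥ 1): keep only the (2k-1)-st and 2k-th
-- occurrences of 0 and of 1.
δ : (j : ℕ) → Word → Word
δ j w = δgo j 0 0 w

GoodPattern : Word → Set
GoodPattern u =
  (u ≡ false ∷ true ∷ false ∷ true ∷ []) ⊎
  (u ≡ true ∷ false ∷ true ∷ false ∷ []) ⊎
  (u ≡ false ∷ true ∷ true ∷ false ∷ []) ⊎
  (u ≡ true ∷ false ∷ false ∷ true ∷ [])

Lbox : ℕ → Language
Lbox b w = count false w ≡ 2 * b × count true w ≡ 2 * b ×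
           (∀ (j : ℕ) → suc j Data.Nat.≤ b → GoodPattern (δ j w))

h : ∀ {m} → Fin m → Fin m → List (Fin m) → Word
h u v [] = []
h u v (x ∷ w) with x ≟ u | x ≟ v
... | yes _ | _     = false ∷ h u v w
... | no _  | yes _ = true ∷ h u v w
... | no _  | no _  = h u v w

record Graph : Set₁ where
  field
    n      : ℕ
    Adj    : Fin n → Fin n → Set
    sym    : ∀ {u v} → Adj u v → Adj v u
    irrefl : ∀ {u} → Adj u u → Data.Empty.⊥
open Graph public

AllLettersOccur : ∀ {m} → List (Fin m) → Set
AllLettersOccur {m} w = ∀ (x : Fin m) → Any (x ≡_) w

-- G is isomorphic to G(L,w) for a word w whose letter set is Fin m.
-- In G(L,w), distinct u, v are adjacent iff h_{u,v}(w) ∈ L.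
InClassG : Language → Graph → Set
InClassG L G =
  Σ ℕ λ m → Σ (List (Fin m)) λ w → AllLettersOccur w ×
  Σ (Fin (n G) ↔ Fin m) λ f →
    ∀ (u v : Fin (n G)) → u ≢ v →
      Adj G u v ⇔ L (h (Inverse.to f u) (Inverse.to f v) w)

record Box (b : ℕ) : Set where
  field
    lo hi : Fin b → ℚ
    lo≤hi : ∀ i → lo i ≤ hi i
open Box public

BoxesIntersect : ∀ {b} → Box b → Box b → Set
BoxesIntersect B C = ∀ i → lo B i ≤ hi C i × lo C i ≤ hi B i

BoxicityAtMost : ℕ → Graph → Set
BoxicityAtMost b G =
  Σ (Fin (n G) → Box b) λ box →
    ∀ (u v : Fin (n G)) → u ≢ v → Adj G u v ⇔ BoxesIntersect (box u) (box v)

{-# OPTIONS --safe #-}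
module Submission where

-- Both directions rest on one fact about a strictly sorted list in which
-- a₀ ≺ a₁ are labelled 0 and b₀ ≺ b₁ are labelled 1: its label word is one of
-- 0101, 1010, 0110, 1001 exactly when neither pair lies entirely before the other,
-- i.e. when the intervals [a₀,a₁] and [b₀,b₁] overlap.
--
-- From a word w to boxes: a letter x occurring 2b times gets the box whose d-th
-- side spans the positions of its (2d+1)-st and (2d+2)-nd occurrences; these are
-- exactly the occurrences that δ_{d+1,d+1} keeps, so δ_{d+1,d+1}(h_{x,y}(w)) is the
-- label word of the four endpoints of the d-th sides of the boxes of x and y.
--
-- From boxes to a word: in every dimension d sort the 2n endpoints of the d-th sides
-- and write down their vertices; concatenating these b blocks gives a word in which
-- h_{x,y} of every block is balanced, so δ_{d+1,d+1}(h_{x,y}(w)) is h_{x,y} of the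
-- d-th block, again the label word of the four endpoints of the d-th sides.

open import Defs hiding (sym; irrefl)

open import Data.Bool using (Bool; true; false; if_then_else_)
import Data.Bool as Bool
open import Data.Bool.Properties using (¬-not)
open import Data.Empty using (⊥-elim)
open import Data.Fin using (Fin; toℕ; fromℕ<)
import Data.Fin as Fin
open import Data.Fin.Properties using (toℕ<n; toℕ-fromℕ<; toℕ-injective)
import Data.Integer as ℤ
import Data.Integer.Properties as ℤₚ
open import Data.List
  using (List; []; _∷_; _++_; map; concat; tabulate; length; filter; allFin; cartesianProduct)
open import Data.List.Membership.Propositional using (_∈_)
open import Data.List.Membership.Propositional.Properties
  using (∈-filter⁺; ∈-filter⁻; ∈-allFin; ∈-cartesianProduct⁺; ∈-map⁺; ∈-concat⁺′; ∈-tabulate⁺)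
open import Data.List.Properties using (++-identityʳ; map-tabulate)
open import Data.List.Relation.Binary.Permutation.Propositional using (↭-sym; ↭⇒↭ₛ)
open import Data.List.Relation.Binary.Permutation.Propositional.Properties using (∈-resp-↭)
import Data.List.Relation.Binary.Permutation.Setoid.Properties as PermutationSetoidProperties
open import Data.List.Relation.Binary.Subset.Propositional using (_⊆_)
open import Data.List.Relation.Unary.All as All using (All; []; _∷_)
open import Data.List.Relation.Unary.AllPairs as AllPairs using (AllPairs; []; _∷_)
import Data.List.Relation.Unary.AllPairs.Properties as AllPairsₚ
open import Data.List.Relation.Unary.Any using (here; there)
open import Data.List.Relation.Unary.Sorted.TotalOrder.Properties using (Sorted⇒AllPairs)
open import Data.List.Relation.Unary.Unique.Propositional using (Unique)
open import Data.List.Relation.Unary.Unique.Propositional.Properties using (cartesianProduct⁺; allFin⁺)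
import Data.List.Sort as Sort
open import Data.Nat using (ℕ; zero; suc; _+_; _*_; _≤_; _<_; _≥_; z≤n; s≤s)
import Data.Nat.Coprimality as Coprime
open import Data.Nat.Properties
open import Data.Product using (Σ-syntax; _×_; _,_; proj₁; proj₂; swap)
open import Data.Product.Function.NonDependent.Propositional using (_×-⇔_)
open import Data.Product.Relation.Binary.Lex.Strict using (×-strictTotalOrder)
open import Data.Rational using (ℚ; mkℚ; *≤*)
import Data.Rational as ℚ
import Data.Rational.Properties as ℚₚ
open import Data.Sum using (_⊎_; inj₁; inj₂; [_,_])
open import Data.Vec.Functional using (updateAt)
open import Data.Vec.Functional.Properties using (updateAt-updates; updateAt-minimal)
open import Function using (_∘_; const)
open import Function.Bundles using (_⇔_; mk⇔; Equivalence; Injection)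
open import Function.Construct.Composition using (_⇔-∘_)
open import Function.Construct.Identity using (↔-id)
open import Function.Construct.Symmetry using (⇔-sym)
open import Function.Properties.Inverse using (↔⇒↣)
open import Level using (0ℓ)
open import Relation.Binary
  using (Rel; IsStrictPartialOrder; StrictTotalOrder; DecTotalOrder; tri<; tri≈; tri>)
import Relation.Binary.Construct.On as On
import Relation.Binary.Properties.StrictTotalOrder as StrictTotalOrderProperties
import Relation.Binary.PropositionalEquality as ≡
open import Relation.Binary.PropositionalEquality
  using (_≡_; _≢_; refl; sym; trans; cong; cong₂; subst; subst₂; resp₂; module ≡-Reasoning)
open import Relation.Nullary using (¬_; Dec; yes; no; does; contradiction; _⊎-dec_; _×-dec_)
open import Relation.Nullary.Decidable using (dec-true; dec-false)
open import Relation.Unary using (Decidable)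

fromℕ : ℕ → ℚ
fromℕ n = mkℚ (ℤ.+ n) 0 (Coprime.sym (Coprime.1-coprimeTo n))

fromℕ-mono-≤ : ∀ {m n} → m ≤ n → fromℕ m ℚ.≤ fromℕ n
fromℕ-mono-≤ {m} {n} m≤n =
  *≤* (subst₂ ℤ._≤_ (sym (ℤₚ.*-identityʳ (ℤ.+ m))) (sym (ℤₚ.*-identityʳ (ℤ.+ n))) (ℤ.+≤+ m≤n))

fromℕ-cancel-≤ : ∀ {m n} → fromℕ m ℚ.≤ fromℕ n → m ≤ n
fromℕ-cancel-≤ {m} {n} (*≤* le) =
  ℤₚ.drop‿+≤+ (subst₂ ℤ._≤_ (ℤₚ.*-identityʳ (ℤ.+ m)) (ℤₚ.*-identityʳ (ℤ.+ n)) le)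

≮⇔fromℕ-≥ : ∀ {m n} → (¬ m < n) ⇔ fromℕ n ℚ.≤ fromℕ m
≮⇔fromℕ-≥ = mk⇔ (fromℕ-mono-≤ ∘ ≮⇒≥) (≤⇒≯ ∘ fromℕ-cancel-≤)

pattern ∈₁ = here refl
pattern ∈₂ = there (here refl)
pattern ∈₃ = there (there (here refl))
pattern ∈₄ = there (there (there (here refl)))

≡-isStrictPartialOrder : ∀ {A : Set} {_≈_ _<_ : Rel A 0ℓ} →
                         IsStrictPartialOrder _≈_ _<_ → IsStrictPartialOrder _≡_ _<_
≡-isStrictPartialOrder spo = record
  { isEquivalence = ≡.isEquivalence
  ; irrefl        = λ { refl → S.irrefl S.Eq.refl }
  ; trans         = S.trans
  ; <-resp-≈      = resp₂ _
  } where module S = IsStrictPartialOrder spo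

Balanced : ℕ → Word → Set
Balanced k s = count false s ≡ k × count true s ≡ k

GoodPattern⇒Balanced : ∀ {s} → GoodPattern s → Balanced 2 s
GoodPattern⇒Balanced (inj₁ refl)               = refl , refl
GoodPattern⇒Balanced (inj₂ (inj₁ refl))        = refl , refl
GoodPattern⇒Balanced (inj₂ (inj₂ (inj₁ refl))) = refl , refl
GoodPattern⇒Balanced (inj₂ (inj₂ (inj₂ refl))) = refl , refl

¬GoodPattern-0011 : ¬ GoodPattern (false ∷ false ∷ true ∷ true ∷ [])
¬GoodPattern-0011 (inj₂ (inj₂ (inj₁ ())))
¬GoodPattern-0011 (inj₂ (inj₂ (inj₂ ())))

¬GoodPattern-1100 : ¬ GoodPattern (true ∷ true ∷ false ∷ false ∷ [])
¬GoodPattern-1100 (inj₂ (inj₂ (inj₁ ())))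
¬GoodPattern-1100 (inj₂ (inj₂ (inj₂ ())))

module StrictlySorted {A : Set} {_≺_ : Rel A 0ℓ}
  (≺-isStrictPartialOrder : IsStrictPartialOrder _≡_ _≺_) where

  open IsStrictPartialOrder ≺-isStrictPartialOrder
    renaming (irrefl to ≺-irrefl; trans to ≺-trans; asym to ≺-asym)

  ∈-comparable : ∀ {xs x y} → AllPairs _≺_ xs → x ∈ xs → y ∈ xs → x ≡ y ⊎ x ≺ y ⊎ y ≺ x
  ∈-comparable (_   ∷ _)   (here refl) (here refl) = inj₁ refl
  ∈-comparable (x≺ ∷ _)   (here refl) (there y∈)  = inj₂ (inj₁ (All.lookup x≺ y∈))
  ∈-comparable (x≺ ∷ _)   (there x∈)  (here refl) = inj₂ (inj₂ (All.lookup x≺ x∈))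
  ∈-comparable (_   ∷ xs↗) (there x∈)  (there y∈)  = ∈-comparable xs↗ x∈ y∈

  strictlySorted-unique : ∀ {xs ys} → AllPairs _≺_ xs → AllPairs _≺_ ys →
                          xs ⊆ ys → ys ⊆ xs → xs ≡ ys
  strictlySorted-unique [] [] _ _ = refl
  strictlySorted-unique [] (_ ∷ _) _ ys⊆[] with () ← ys⊆[] (here refl)
  strictlySorted-unique (_ ∷ _) [] xs⊆[] _ with () ← xs⊆[] (here refl)
  strictlySorted-unique {x ∷ _} (x≺ ∷ xs↗) (y≺ ∷ ys↗) xs⊆ys ys⊆xs
    with xs⊆ys (here refl) | ys⊆xs (here refl)
  ... | here refl | _ =
    cong (x ∷_) (strictlySorted-unique xs↗ ys↗ (drop-head x≺ xs⊆ys) (drop-head y≺ ys⊆xs))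
    where
    drop-head : ∀ {x xs ys} → All (x ≺_) xs → (x ∷ xs) ⊆ (x ∷ ys) → xs ⊆ ys
    drop-head x≺xs x∷xs⊆x∷ys e∈xs with x∷xs⊆x∷ys (there e∈xs)
    ... | here refl  = contradiction (All.lookup x≺xs e∈xs) (≺-irrefl refl)
    ... | there e∈ys = e∈ys
  ... | there x∈ys | here refl  = contradiction (All.lookup y≺ x∈ys) (≺-irrefl refl)
  ... | there x∈ys | there y∈xs = ⊥-elim (≺-asym (All.lookup y≺ x∈ys) (All.lookup x≺ y∈xs))

  module Interleaving (label : A → Bool) {a₀ a₁ b₀ b₁ : A}
    (a₀-label : label a₀ ≡ false) (a₁-label : label a₁ ≡ false)
    (b₀-label : label b₀ ≡ true)  (b₁-label : label b₁ ≡ true)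
    (a₀≺a₁ : a₀ ≺ a₁) (b₀≺b₁ : b₀ ≺ b₁)
    {F : List A} (F↗ : AllPairs _≺_ F)
    (F⊆ : F ⊆ a₀ ∷ a₁ ∷ b₀ ∷ b₁ ∷ []) (⊆F : a₀ ∷ a₁ ∷ b₀ ∷ b₁ ∷ [] ⊆ F) where

    private
      Q : List A
      Q = a₀ ∷ a₁ ∷ b₀ ∷ b₁ ∷ []

      comparable : ∀ {a b} → a ∈ Q → b ∈ Q → label a ≡ false → label b ≡ true → a ≺ b ⊎ b ≺ a
      comparable a∈ b∈ a-label b-label with ∈-comparable F↗ (⊆F a∈) (⊆F b∈)
      ... | inj₁ refl = contradiction (trans (sym a-label) b-label) λ ()
      ... | inj₂ a≺b⊎b≺a = a≺b⊎b≺a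

      -- The two membership lists say that p, q, r, s is a rearrangement of Q.
      sorted-as : ∀ {p q r s} → p ≺ q → q ≺ r → r ≺ s →
                  All (_∈ p ∷ q ∷ r ∷ s ∷ []) Q → All (_∈ Q) (p ∷ q ∷ r ∷ s ∷ []) →
                  F ≡ p ∷ q ∷ r ∷ s ∷ []
      sorted-as {p} {q} {r} {s} p≺q q≺r r≺s Q⊆ ⊆Q = strictlySorted-unique F↗ chain
          (All.lookup Q⊆ ∘ F⊆) (⊆F ∘ All.lookup ⊆Q)
        where
        chain : AllPairs _≺_ (p ∷ q ∷ r ∷ s ∷ [])
        chain = (p≺q ∷ ≺-trans p≺q q≺r ∷ ≺-trans p≺q (≺-trans q≺r r≺s) ∷ [])
              ∷ (q≺r ∷ ≺-trans q≺r r≺s ∷ []) ∷ (r≺s ∷ []) ∷ [] ∷ []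

    arrangement : (a₁ ≺ b₀ × map label F ≡ false ∷ false ∷ true ∷ true ∷ [])
                ⊎ (b₁ ≺ a₀ × map label F ≡ true ∷ true ∷ false ∷ false ∷ [])
                ⊎ (b₀ ≺ a₁ × a₀ ≺ b₁ × GoodPattern (map label F))
    arrangement with comparable ∈₂ ∈₃ a₁-label b₀-label
    ... | inj₁ a₁≺b₀
      rewrite sorted-as a₀≺a₁ a₁≺b₀ b₀≺b₁ (∈₁ ∷ ∈₂ ∷ ∈₃ ∷ ∈₄ ∷ []) (∈₁ ∷ ∈₂ ∷ ∈₃ ∷ ∈₄ ∷ [])
            | a₀-label | a₁-label | b₀-label | b₁-label
      = inj₁ (a₁≺b₀ , refl)
    ... | inj₂ b₀≺a₁ with comparable ∈₁ ∈₄ a₀-label b₁-label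
    ...   | inj₂ b₁≺a₀
      rewrite sorted-as b₀≺b₁ b₁≺a₀ a₀≺a₁ (∈₃ ∷ ∈₄ ∷ ∈₁ ∷ ∈₂ ∷ []) (∈₃ ∷ ∈₄ ∷ ∈₁ ∷ ∈₂ ∷ [])
            | a₀-label | a₁-label | b₀-label | b₁-label
      = inj₂ (inj₁ (b₁≺a₀ , refl))
    ...   | inj₁ a₀≺b₁ = inj₂ (inj₂ (b₀≺a₁ , a₀≺b₁ , alternating))
      where
      alternating : GoodPattern (map label F)
      alternating with comparable ∈₁ ∈₃ a₀-label b₀-label | comparable ∈₂ ∈₄ a₁-label b₁-label
      ... | inj₁ a₀≺b₀ | inj₁ a₁≺b₁
        rewrite sorted-as a₀≺b₀ b₀≺a₁ a₁≺b₁ (∈₁ ∷ ∈₃ ∷ ∈₂ ∷ ∈₄ ∷ []) (∈₁ ∷ ∈₃ ∷ ∈₂ ∷ ∈₄ ∷ [])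
              | a₀-label | a₁-label | b₀-label | b₁-label
        = inj₁ refl
      ... | inj₁ a₀≺b₀ | inj₂ b₁≺a₁
        rewrite sorted-as a₀≺b₀ b₀≺b₁ b₁≺a₁ (∈₁ ∷ ∈₄ ∷ ∈₂ ∷ ∈₃ ∷ []) (∈₁ ∷ ∈₃ ∷ ∈₄ ∷ ∈₂ ∷ [])
              | a₀-label | a₁-label | b₀-label | b₁-label
        = inj₂ (inj₂ (inj₁ refl))
      ... | inj₂ b₀≺a₀ | inj₁ a₁≺b₁
        rewrite sorted-as b₀≺a₀ a₀≺a₁ a₁≺b₁ (∈₂ ∷ ∈₃ ∷ ∈₁ ∷ ∈₄ ∷ []) (∈₃ ∷ ∈₁ ∷ ∈₂ ∷ ∈₄ ∷ [])
              | a₀-label | a₁-label | b₀-label | b₁-label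
        = inj₂ (inj₂ (inj₂ refl))
      ... | inj₂ b₀≺a₀ | inj₂ b₁≺a₁
        rewrite sorted-as b₀≺a₀ a₀≺b₁ b₁≺a₁ (∈₂ ∷ ∈₄ ∷ ∈₁ ∷ ∈₃ ∷ []) (∈₃ ∷ ∈₁ ∷ ∈₄ ∷ ∈₂ ∷ [])
              | a₀-label | a₁-label | b₀-label | b₁-label
        = inj₂ (inj₁ refl)

    labels-balanced : Balanced 2 (map label F)
    labels-balanced with arrangement
    ... | inj₁ (_ , labels) rewrite labels = refl , refl
    ... | inj₂ (inj₁ (_ , labels)) rewrite labels = refl , refl
    ... | inj₂ (inj₂ (_ , _ , good)) = GoodPattern⇒Balanced good

    labels-good⇔overlap : GoodPattern (map label F) ⇔ (¬ b₁ ≺ a₀ × ¬ a₁ ≺ b₀)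
    labels-good⇔overlap with arrangement
    ... | inj₁ (a₁≺b₀ , labels) rewrite labels =
      mk⇔ (⊥-elim ∘ ¬GoodPattern-0011) (λ (_ , a₁⊀b₀) → ⊥-elim (a₁⊀b₀ a₁≺b₀))
    ... | inj₂ (inj₁ (b₁≺a₀ , labels)) rewrite labels =
      mk⇔ (⊥-elim ∘ ¬GoodPattern-1100) (λ (b₁⊀a₀ , _) → ⊥-elim (b₁⊀a₀ b₁≺a₀))
    ... | inj₂ (inj₂ (b₀≺a₁ , a₀≺b₁ , good)) =
      mk⇔ (const (≺-asym a₀≺b₁ , ≺-asym b₀≺a₁)) (const good)

keepIdx-2j : ∀ j → keepIdx j (2 * j) ≡ true
keepIdx-2j j with 2 * j ≟ 2 * j
... | yes _     = refl
... | no 2j≢2j = contradiction refl 2j≢2j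

keepIdx-2j+1 : ∀ j → keepIdx j (suc (2 * j)) ≡ true
keepIdx-2j+1 j with suc (2 * j) ≟ 2 * j | suc (2 * j) ≟ suc (2 * j)
... | yes _ | _     = refl
... | no _  | yes _ = refl
... | no _  | no ≢  = contradiction refl ≢

keepIdx-true⇒ : ∀ j i → keepIdx j i ≡ true → i ≡ 2 * j ⊎ i ≡ suc (2 * j)
keepIdx-true⇒ j i with i ≟ 2 * j | i ≟ suc (2 * j)
... | yes i≡2j | _        = const (inj₁ i≡2j)
... | no _     | yes i≡2j+1 = const (inj₂ i≡2j+1)
... | no _     | no _     = λ ()

keepIdx-false : ∀ {j i} → i ≢ 2 * j → i ≢ suc (2 * j) → keepIdx j i ≡ false
keepIdx-false {j} {i} i≢2j i≢2j+1 = ¬-not ([ i≢2j , i≢2j+1 ] ∘ keepIdx-true⇒ j i)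

keepIdx-window : ∀ {j i} → 2 * j ≤ i → i < 2 + 2 * j → keepIdx j i ≡ true
keepIdx-window {j} 2j≤i i<2j+2 with m≤n⇒m<n∨m≡n 2j≤i
... | inj₂ refl  = keepIdx-2j j
... | inj₁ 2j<i rewrite ≤-antisym (≤-pred i<2j+2) 2j<i = keepIdx-2j+1 j

keepIdx-below : ∀ {j i} → i < 2 * j → keepIdx j i ≡ false
keepIdx-below i<2j = keepIdx-false (<⇒≢ i<2j) (<⇒≢ (m<n⇒m<1+n i<2j))

keepIdx-above : ∀ {j i} → 2 + 2 * j ≤ i → keepIdx j i ≡ false
keepIdx-above 2j+2≤i =
  keepIdx-false (>⇒≢ (<-trans (n<1+n _) 2j+2≤i)) (>⇒≢ 2j+2≤i)

private
  shift-≤ : ∀ {i c n} → i + suc c ≤ n → suc i + c ≤ n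
  shift-≤ {i} {c} {n} = subst (_≤ n) (+-suc i c)

  head-< : ∀ {i c n} → i + suc c ≤ n → i < n
  head-< {i} {c} = ≤-trans (s≤s (m≤m+n i c)) ∘ shift-≤

δgo-step₀ : ∀ {j i₀ i₁ s b} → keepIdx j i₀ ≡ b →
            δgo j i₀ i₁ (false ∷ s) ≡ (if b then false ∷ δgo j (suc i₀) i₁ s else δgo j (suc i₀) i₁ s)
δgo-step₀ {j} {i₀} refl with keepIdx j i₀
... | true  = refl
... | false = refl

δgo-step₁ : ∀ {j i₀ i₁ s b} → keepIdx j i₁ ≡ b →
            δgo j i₀ i₁ (true ∷ s) ≡ (if b then true ∷ δgo j i₀ (suc i₁) s else δgo j i₀ (suc i₁) s)
δgo-step₁ {j} {i₁ = i₁} refl with keepIdx j i₁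
... | true  = refl
... | false = refl

δgo-keep : ∀ j i₀ i₁ s → 2 * j ≤ i₀ → i₀ + count false s ≤ 2 + 2 * j →
           2 * j ≤ i₁ → i₁ + count true s ≤ 2 + 2 * j → δgo j i₀ i₁ s ≡ s
δgo-keep j i₀ i₁ [] _ _ _ _ = refl
δgo-keep j i₀ i₁ (false ∷ s) lo₀ hi₀ lo₁ hi₁ =
  trans (δgo-step₀ (keepIdx-window lo₀ (head-< hi₀)))
        (cong (false ∷_) (δgo-keep j (suc i₀) i₁ s (m≤n⇒m≤1+n lo₀) (shift-≤ hi₀) lo₁ hi₁))
δgo-keep j i₀ i₁ (true ∷ s) lo₀ hi₀ lo₁ hi₁ =
  trans (δgo-step₁ (keepIdx-window lo₁ (head-< hi₁)))
        (cong (true ∷_) (δgo-keep j i₀ (suc i₁) s lo₀ hi₀ (m≤n⇒m≤1+n lo₁) (shift-≤ hi₁)))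

δgo-drop-below : ∀ j i₀ i₁ s → i₀ + count false s ≤ 2 * j → i₁ + count true s ≤ 2 * j →
                 δgo j i₀ i₁ s ≡ []
δgo-drop-below j i₀ i₁ [] _ _ = refl
δgo-drop-below j i₀ i₁ (false ∷ s) hi₀ hi₁ =
  trans (δgo-step₀ (keepIdx-below (head-< hi₀))) (δgo-drop-below j (suc i₀) i₁ s (shift-≤ hi₀) hi₁)
δgo-drop-below j i₀ i₁ (true ∷ s) hi₀ hi₁ =
  trans (δgo-step₁ (keepIdx-below (head-< hi₁))) (δgo-drop-below j i₀ (suc i₁) s hi₀ (shift-≤ hi₁))

δgo-drop-above : ∀ j i₀ i₁ s → 2 + 2 * j ≤ i₀ → 2 + 2 * j ≤ i₁ → δgo j i₀ i₁ s ≡ []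
δgo-drop-above j i₀ i₁ [] _ _ = refl
δgo-drop-above j i₀ i₁ (false ∷ s) lo₀ lo₁ =
  trans (δgo-step₀ (keepIdx-above lo₀)) (δgo-drop-above j (suc i₀) i₁ s (m≤n⇒m≤1+n lo₀) lo₁)
δgo-drop-above j i₀ i₁ (true ∷ s) lo₀ lo₁ =
  trans (δgo-step₁ (keepIdx-above lo₁)) (δgo-drop-above j i₀ (suc i₁) s lo₀ (m≤n⇒m≤1+n lo₁))

δgo-++ : ∀ j i₀ i₁ s t →
         δgo j i₀ i₁ (s ++ t) ≡ δgo j i₀ i₁ s ++ δgo j (i₀ + count false s) (i₁ + count true s) t
δgo-++ j i₀ i₁ [] t = sym (cong₂ (λ c₀ c₁ → δgo j c₀ c₁ t) (+-identityʳ i₀) (+-identityʳ i₁))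
δgo-++ j i₀ i₁ (false ∷ s) t rewrite +-suc i₀ (count false s) with keepIdx j i₀
... | true  = cong (false ∷_) (δgo-++ j (suc i₀) i₁ s t)
... | false = δgo-++ j (suc i₀) i₁ s t
δgo-++ j i₀ i₁ (true ∷ s) t rewrite +-suc i₁ (count true s) with keepIdx j i₁
... | true  = cong (true ∷_) (δgo-++ j i₀ (suc i₁) s t)
... | false = δgo-++ j i₀ (suc i₁) s t

count-++ : ∀ c s t → count c (s ++ t) ≡ count c s + count c t
count-++ false []          t = refl
count-++ true  []          t = refl
count-++ false (false ∷ s) t = cong suc (count-++ false s t)
count-++ false (true ∷ s)  t = count-++ false s t
count-++ true  (false ∷ s) t = count-++ true s t
count-++ true  (true ∷ s)  t = cong suc (count-++ true s t)

Balanced-++ : ∀ {k l} s t → Balanced k s → Balanced l t → Balanced (k + l) (s ++ t)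
Balanced-++ s t (s₀ , s₁) (t₀ , t₁) =
  trans (count-++ false s t) (cong₂ _+_ s₀ t₀) , trans (count-++ true s t) (cong₂ _+_ s₁ t₁)

Balanced-concat : ∀ {n} (s : Fin n → Word) → (∀ d → Balanced 2 (s d)) →
                  Balanced (2 * n) (concat (tabulate s))
Balanced-concat {zero}  s _ = refl , refl
Balanced-concat {suc n} s balanced =
  subst (λ k → Balanced k (concat (tabulate s))) (sym (*-suc 2 n))
        (Balanced-++ (s Fin.zero) (concat (tabulate (s ∘ Fin.suc)))
                     (balanced Fin.zero) (Balanced-concat (s ∘ Fin.suc) (balanced ∘ Fin.suc)))

double-suc : ∀ k → 2 * suc k ≡ 2 * k + 2
double-suc k = trans (*-suc 2 k) (+-comm 2 (2 * k))

δgo-balanced-window : ∀ j s → Balanced 2 s → δgo j (2 * j) (2 * j) s ≡ s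
δgo-balanced-window j s (c₀ , c₁) = δgo-keep j _ _ s ≤-refl (window c₀) ≤-refl (window c₁)
  where
  window : ∀ {c} → c ≡ 2 → 2 * j + c ≤ 2 + 2 * j
  window refl = ≤-reflexive (+-comm (2 * j) 2)

δgo-balanced-before : ∀ {k j} s → k < j → Balanced 2 s → δgo j (2 * k) (2 * k) s ≡ []
δgo-balanced-before {k} {j} s k<j (c₀ , c₁) = δgo-drop-below j _ _ s (before c₀) (before c₁)
  where
  before : ∀ {c} → c ≡ 2 → 2 * k + c ≤ 2 * j
  before refl = subst (_≤ 2 * j) (double-suc k) (*-monoʳ-≤ 2 k<j)

δgo-concat : ∀ {n} (s : Fin n → Word) → (∀ d → Balanced 2 (s d)) →
             ∀ k d → δgo (toℕ d + k) (2 * k) (2 * k) (concat (tabulate s)) ≡ s d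
δgo-concat {suc n} s balanced k d = begin
    δgo j (2 * k) (2 * k) (s₀ ++ rest)
  ≡⟨ δgo-++ j (2 * k) (2 * k) s₀ rest ⟩
    δgo j (2 * k) (2 * k) s₀ ++ δgo j (2 * k + count false s₀) (2 * k + count true s₀) rest
  ≡⟨ cong₂ (λ i₀ i₁ → δgo j (2 * k) (2 * k) s₀ ++ δgo j i₀ i₁ rest)
           (next-offset (proj₁ (balanced Fin.zero))) (next-offset (proj₂ (balanced Fin.zero))) ⟩
    δgo j (2 * k) (2 * k) s₀ ++ δgo j (2 * suc k) (2 * suc k) rest
  ≡⟨ split d ⟩
    s d ∎
  where
  open ≡-Reasoning

  j : ℕ
  j = toℕ d + k

  s₀ rest : Word
  s₀   = s Fin.zero
  rest = concat (tabulate (s ∘ Fin.suc))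

  next-offset : ∀ {c} → c ≡ 2 → 2 * k + c ≡ 2 * suc k
  next-offset refl = sym (double-suc k)

  split : ∀ d → δgo (toℕ d + k) (2 * k) (2 * k) s₀ ++ δgo (toℕ d + k) (2 * suc k) (2 * suc k) rest ≡ s d
  split Fin.zero = begin
      δgo k (2 * k) (2 * k) s₀ ++ δgo k (2 * suc k) (2 * suc k) rest
    ≡⟨ cong₂ _++_ (δgo-balanced-window k s₀ (balanced Fin.zero))
                  (δgo-drop-above k _ _ rest above above) ⟩
      s₀ ++ []
    ≡⟨ ++-identityʳ s₀ ⟩
      s₀ ∎
    where
    above : 2 + 2 * k ≤ 2 * suc k
    above = ≤-reflexive (sym (*-suc 2 k))
  split (Fin.suc d′) = cong₂ _++_
    (δgo-balanced-before s₀ (s≤s (m≤n+m k (toℕ d′))) (balanced Fin.zero))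
    (subst (λ j′ → δgo j′ (2 * suc k) (2 * suc k) rest ≡ s (Fin.suc d′)) (+-suc (toℕ d′) k)
           (δgo-concat (s ∘ Fin.suc) (balanced ∘ Fin.suc) (suc k) d′))

δ-concat : ∀ {n} (s : Fin n → Word) → (∀ d → Balanced 2 (s d)) →
           ∀ d → δ (toℕ d) (concat (tabulate s)) ≡ s d
δ-concat s balanced d =
  subst (λ j → δgo j 0 0 (concat (tabulate s)) ≡ s d) (+-identityʳ (toℕ d)) (δgo-concat s balanced 0 d)

module _ {m : ℕ} (u v : Fin m) where

  h-++ : ∀ xs ys → h u v (xs ++ ys) ≡ h u v xs ++ h u v ys
  h-++ [] ys = refl
  h-++ (x ∷ xs) ys with x Fin.≟ u | x Fin.≟ v
  ... | yes _ | _     = cong (false ∷_) (h-++ xs ys)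
  ... | no _  | yes _ = cong (true ∷_) (h-++ xs ys)
  ... | no _  | no _  = h-++ xs ys

  h-concat : ∀ xss → h u v (concat xss) ≡ concat (map (h u v) xss)
  h-concat []         = refl
  h-concat (xs ∷ xss) = trans (h-++ xs (concat xss)) (cong (h u v xs ++_) (h-concat xss))

  onUV? : ∀ {A : Set} (f : A → Fin m) → Decidable (λ a → f a ≡ u ⊎ f a ≡ v)
  onUV? f a = f a Fin.≟ u ⊎-dec f a Fin.≟ v

  h-map : u ≢ v → ∀ {A : Set} (f : A → Fin m) xs →
          h u v (map f xs) ≡ map (λ a → does (f a Fin.≟ v)) (filter (onUV? f) xs)
  h-map u≢v f [] = refl
  h-map u≢v f (x ∷ xs) with f x Fin.≟ u | f x Fin.≟ v
  ... | yes fx≡u | yes fx≡v = contradiction (trans (sym fx≡u) fx≡v) u≢v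
  ... | yes _    | no fx≢v  = cong₂ _∷_ (sym (dec-false (f x Fin.≟ v) fx≢v)) (h-map u≢v f xs)
  ... | no _     | yes fx≡v = cong₂ _∷_ (sym (dec-true (f x Fin.≟ v) fx≡v)) (h-map u≢v f xs)
  ... | no _     | no _     = h-map u≢v f xs

multiplicity : ∀ {m} → Fin m → List (Fin m) → ℕ
multiplicity y [] = 0
multiplicity y (x ∷ w) with x Fin.≟ y
... | yes _ = suc (multiplicity y w)
... | no _  = multiplicity y w

count-h : ∀ {m} {u v : Fin m} → u ≢ v → ∀ w →
          count false (h u v w) ≡ multiplicity u w × count true (h u v w) ≡ multiplicity v w
count-h u≢v [] = refl , refl
count-h {u = u} {v} u≢v (x ∷ w) with x Fin.≟ u | x Fin.≟ v
... | yes refl | yes refl = contradiction refl u≢v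
... | yes refl | no _     = cong suc (proj₁ (count-h u≢v w)) , proj₂ (count-h u≢v w)
... | no _     | yes refl = proj₁ (count-h u≢v w) , cong suc (proj₂ (count-h u≢v w))
... | no _     | no _     = count-h u≢v w

-- (letter, rank among the occurrences of that letter counting from 0, position)
Occurrence : ℕ → Set
Occurrence m = Fin m × ℕ × ℕ

place : ∀ {m} → Occurrence m → ℕ
place (_ , _ , q) = q

-- c y counts the occurrences of y already read, p is the current position.
annotate : ∀ {m} → (Fin m → ℕ) → ℕ → List (Fin m) → List (Occurrence m)
annotate c p []      = []
annotate c p (x ∷ w) = (x , c x , p) ∷ annotate (updateAt c x suc) (suc p) w

occurrences : ∀ {m} → List (Fin m) → List (Occurrence m)
occurrences = annotate (const 0) 0

position : ∀ {m} → Fin m → ℕ → List (Fin m) → ℕ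
position y k [] = 0
position y k (x ∷ w) with x Fin.≟ y | k
... | yes _ | zero   = 0
... | yes _ | suc k′ = suc (position y k′ w)
... | no _  | k′     = suc (position y k′ w)

position-< : ∀ {m} (y : Fin m) k w → suc k < multiplicity y w → position y k w < position y (suc k) w
position-< y zero    (x ∷ w) k+1<μ with x Fin.≟ y
... | yes _ = s≤s z≤n
... | no _  = s≤s (position-< y zero w k+1<μ)
position-< y (suc k) (x ∷ w) k+1<μ with x Fin.≟ y
... | yes _ = s≤s (position-< y k w (≤-pred k+1<μ))
... | no _  = s≤s (position-< y (suc k) w k+1<μ)

position-≤-length : ∀ {m} (y : Fin m) k w → position y k w ≤ length w
position-≤-length y k       []      = z≤n
position-≤-length y zero    (x ∷ w) with x Fin.≟ y
... | yes _ = z≤n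
... | no _  = s≤s (position-≤-length y zero w)
position-≤-length y (suc k) (x ∷ w) with x Fin.≟ y
... | yes _ = s≤s (position-≤-length y k w)
... | no _  = s≤s (position-≤-length y (suc k) w)

module _ {m : ℕ} where

  annotate-≥ : ∀ c p w → All (λ o → p ≤ place o) (annotate {m} c p w)
  annotate-≥ c p []      = []
  annotate-≥ c p (x ∷ w) = ≤-refl ∷ All.map <⇒≤ (annotate-≥ (updateAt c x suc) (suc p) w)

  annotate-sorted : ∀ c p w → AllPairs (λ o o′ → place o < place o′) (annotate {m} c p w)
  annotate-sorted c p []      = []
  annotate-sorted c p (x ∷ w) = annotate-≥ (updateAt c x suc) (suc p) w ∷ annotate-sorted _ _ w

  ∈-annotate⁻ : ∀ c p w {y k q} → (y , k , q) ∈ annotate {m} c p w →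
                Σ[ r ∈ ℕ ] k ≡ c y + r × q ≡ p + position y r w
  ∈-annotate⁻ c p (x ∷ w) (here refl) with x Fin.≟ x
  ... | yes _    = 0 , sym (+-identityʳ (c x)) , sym (+-identityʳ p)
  ... | no x≢x = contradiction refl x≢x
  ∈-annotate⁻ c p (x ∷ w) {y} (there o∈) with ∈-annotate⁻ (updateAt c x suc) (suc p) w o∈ | x Fin.≟ y
  ... | r , k≡ , q≡ | yes refl =
    suc r , trans k≡ (trans (cong (_+ r) (updateAt-updates x c)) (sym (+-suc (c x) r))) ,
            trans q≡ (sym (+-suc p _))
  ... | r , k≡ , q≡ | no x≢y =
    r , trans k≡ (cong (_+ r) (updateAt-minimal y x c (x≢y ∘ sym))) , trans q≡ (sym (+-suc p _))

  ∈-annotate⁺ : ∀ c p w {y r} → r < multiplicity y w →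
                (y , c y + r , p + position y r w) ∈ annotate {m} c p w
  ∈-annotate⁺ c p (x ∷ w) {y} {r} r<μ with x Fin.≟ y | r
  ... | yes refl | zero   = here (cong₂ (λ k q → x , k , q) (+-identityʳ (c x)) (+-identityʳ p))
  ... | yes refl | suc r′ =
    there (subst₂ (λ k q → (x , k , q) ∈ annotate (updateAt c x suc) (suc p) w)
                  (trans (cong (_+ r′) (updateAt-updates x c)) (sym (+-suc (c x) r′))) (sym (+-suc p _))
                  (∈-annotate⁺ (updateAt c x suc) (suc p) w (≤-pred r<μ)))
  ... | no x≢y | r′ =
    there (subst₂ (λ k q → (y , k , q) ∈ annotate (updateAt c x suc) (suc p) w)
                  (cong (_+ r′) (updateAt-minimal y x c (x≢y ∘ sym))) (sym (+-suc p _))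
                  (∈-annotate⁺ (updateAt c x suc) (suc p) w r<μ))

module KeptOccurrences {m : ℕ} {u v : Fin m} (u≢v : u ≢ v) (j : ℕ) where

  isV : Occurrence m → Bool
  isV (y , _ , _) = does (y Fin.≟ v)

  Kept : Occurrence m → Set
  Kept (y , k , _) = (y ≡ u ⊎ y ≡ v) × keepIdx j k ≡ true

  kept? : Decidable Kept
  kept? (y , k , _) = (y Fin.≟ u ⊎-dec y Fin.≟ v) ×-dec (keepIdx j k Bool.≟ true)

  private
    recount : ∀ (c : Fin m → ℕ) w {i₀ i₁ t} → c u ≡ i₀ → c v ≡ i₁ →
              δgo j (c u) (c v) (h u v w) ≡ t → δgo j i₀ i₁ (h u v w) ≡ t
    recount _ _ refl refl eq = eq

  δ-h-annotate : ∀ c p w → δgo j (c u) (c v) (h u v w) ≡ map isV (filter kept? (annotate c p w))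
  δ-h-annotate c p [] = refl
  δ-h-annotate c p (x ∷ w) with x Fin.≟ u | x Fin.≟ v
  ... | yes refl | yes x≡v = contradiction x≡v u≢v
  ... | yes refl | no x≢v with keepIdx j (c x)
  ...   | true  = cong₂ _∷_ (sym (dec-false (x Fin.≟ v) x≢v))
                    (recount (updateAt c x suc) w
                             (updateAt-updates x c) (updateAt-minimal v x c (x≢v ∘ sym))
                             (δ-h-annotate (updateAt c x suc) (suc p) w))
  ...   | false = recount (updateAt c x suc) w
                          (updateAt-updates x c) (updateAt-minimal v x c (x≢v ∘ sym))
                          (δ-h-annotate (updateAt c x suc) (suc p) w)
  δ-h-annotate c p (x ∷ w) | no x≢u | yes refl with keepIdx j (c x)
  ...   | true  = cong₂ _∷_ (sym (dec-true (x Fin.≟ x) refl))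
                    (recount (updateAt c x suc) w
                             (updateAt-minimal u x c (x≢u ∘ sym)) (updateAt-updates x c)
                             (δ-h-annotate (updateAt c x suc) (suc p) w))
  ...   | false = recount (updateAt c x suc) w
                          (updateAt-minimal u x c (x≢u ∘ sym)) (updateAt-updates x c)
                          (δ-h-annotate (updateAt c x suc) (suc p) w)
  δ-h-annotate c p (x ∷ w) | no x≢u | no x≢v =
    recount (updateAt c x suc) w
            (updateAt-minimal u x c (x≢u ∘ sym)) (updateAt-minimal v x c (x≢v ∘ sym))
            (δ-h-annotate (updateAt c x suc) (suc p) w)

  module _ (w : List (Fin m)) (u-enough : suc (2 * j) < multiplicity u w)
           (v-enough : suc (2 * j) < multiplicity v w) where

    private
      F : List (Occurrence m)
      F = filter kept? (occurrences w)

      occurrence : Fin m → ℕ → Occurrence m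
      occurrence y k = y , k , position y k w

      Q : List (Occurrence m)
      Q = occurrence u (2 * j) ∷ occurrence u (suc (2 * j)) ∷
          occurrence v (2 * j) ∷ occurrence v (suc (2 * j)) ∷ []

      F⊆Q : F ⊆ Q
      F⊆Q {y , k , q} o∈F with ∈-filter⁻ kept? o∈F
      ... | o∈ , y∈uv , kept with ∈-annotate⁻ (const 0) 0 w o∈ | keepIdx-true⇒ j k kept
      ... | _ , refl , refl | k∈window with y∈uv | k∈window
      ...   | inj₁ refl | inj₁ refl = ∈₁
      ...   | inj₁ refl | inj₂ refl = ∈₂
      ...   | inj₂ refl | inj₁ refl = ∈₃
      ...   | inj₂ refl | inj₂ refl = ∈₄

      Q⊆F : Q ⊆ F
      Q⊆F = All.lookup {P = _∈ F}
        ( kept (inj₁ refl) u-enough′ (keepIdx-2j j) ∷ kept (inj₁ refl) u-enough (keepIdx-2j+1 j)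
        ∷ kept (inj₂ refl) v-enough′ (keepIdx-2j j) ∷ kept (inj₂ refl) v-enough (keepIdx-2j+1 j) ∷ [])
        where
        kept : ∀ {y k} → y ≡ u ⊎ y ≡ v → k < multiplicity y w → keepIdx j k ≡ true → occurrence y k ∈ F
        kept y∈uv k<μ k-kept = ∈-filter⁺ kept? (∈-annotate⁺ (const 0) 0 w k<μ) (y∈uv , k-kept)
        u-enough′ : 2 * j < multiplicity u w
        u-enough′ = <-trans (n<1+n (2 * j)) u-enough
        v-enough′ : 2 * j < multiplicity v w
        v-enough′ = <-trans (n<1+n (2 * j)) v-enough

    δ-h-good⇔overlap :
      GoodPattern (δ j (h u v w)) ⇔
      (fromℕ (position u (2 * j) w) ℚ.≤ fromℕ (position v (suc (2 * j)) w) ×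
       fromℕ (position v (2 * j) w) ℚ.≤ fromℕ (position u (suc (2 * j)) w))
    δ-h-good⇔overlap rewrite δ-h-annotate (const 0) 0 w =
      (≮⇔fromℕ-≥ ×-⇔ ≮⇔fromℕ-≥) ⇔-∘ labels-good⇔overlap
      where
      open StrictlySorted.Interleaving
        (≡-isStrictPartialOrder (On.isStrictPartialOrder place <-isStrictPartialOrder))
        isV (dec-false (u Fin.≟ v) u≢v) (dec-false (u Fin.≟ v) u≢v)
        (dec-true (v Fin.≟ v) refl) (dec-true (v Fin.≟ v) refl)
        (position-< u (2 * j) w u-enough) (position-< v (2 * j) w v-enough)
        (AllPairsₚ.filter⁺ kept? (annotate-sorted (const 0) 0 w)) F⊆Q Q⊆F

Π-⇔ : ∀ {A : Set} {P Q : A → Set} → (∀ a → P a ⇔ Q a) → (∀ a → P a) ⇔ (∀ a → Q a)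
Π-⇔ P⇔Q = mk⇔ (λ p a → Equivalence.to (P⇔Q a) (p a)) (λ q a → Equivalence.from (P⇔Q a) (q a))

Lbox⇔ : ∀ {b s} → Balanced (2 * b) s → Lbox b s ⇔ (∀ (d : Fin b) → GoodPattern (δ (toℕ d) s))
Lbox⇔ {s = s} (s₀ , s₁) = mk⇔
  (λ (_ , _ , good) d → good (toℕ d) (toℕ<n d))
  (λ good → s₀ , s₁ , λ j j<b → subst (λ j → GoodPattern (δ j s)) (toℕ-fromℕ< j<b) (good (fromℕ< j<b)))

odd<double : ∀ {j b} → j < b → suc (2 * j) < 2 * b
odd<double {j} {b} j<b = subst (_≤ 2 * b) (*-suc 2 j) (*-monoʳ-≤ 2 j<b)

point : ∀ {b} → ℚ → Box b
point q = record { lo = const q ; hi = const q ; lo≤hi = const ℚₚ.≤-refl }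

BoxesIntersect-sym : ∀ {b} {B C : Box b} → BoxesIntersect B C → BoxesIntersect C B
BoxesIntersect-sym B∩C i = swap (B∩C i)

module WordBoxes {m b : ℕ} (w : List (Fin m)) where

  Proper : Fin m → Set
  Proper x = multiplicity x w ≡ 2 * b

  occurrenceBox : ∀ x → Proper x → Box b
  occurrenceBox x proper = record
    { lo    = λ d → fromℕ (position x (2 * toℕ d) w)
    ; hi    = λ d → fromℕ (position x (suc (2 * toℕ d)) w)
    ; lo≤hi = λ d → fromℕ-mono-≤ (<⇒≤ (position-< x _ w
                      (subst (suc (2 * toℕ d) <_) (sym proper) (odd<double (toℕ<n d)))))
    }

  -- An improper letter is isolated in G(Lbox b, w); its box is a point beyond all positions.
  boxOf : ∀ x → Dec (Proper x) → Box b
  boxOf x (yes proper) = occurrenceBox x proper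
  boxOf x (no _)       = point (fromℕ (suc (length w + toℕ x)))

  box : Fin m → Box b
  box x = boxOf x (multiplicity x w ≟ 2 * b)

  improper-disjoint : Fin b → ∀ {x y} → x ≢ y → (¬px : ¬ Proper x) (py? : Dec (Proper y)) →
                      ¬ BoxesIntersect (boxOf x (no ¬px)) (boxOf y py?)
  improper-disjoint d₀ {y = y} _ _ (yes _) x∩y =
    <⇒≱ (s≤s (m≤m+n (length w) _)) (≤-trans (fromℕ-cancel-≤ (proj₁ (x∩y d₀))) (position-≤-length y _ w))
  improper-disjoint d₀ x≢y _ (no _) x∩y =
    x≢y (toℕ-injective (+-cancelˡ-≡ (length w) _ _ (suc-injective
      (≤-antisym (fromℕ-cancel-≤ (proj₁ (x∩y d₀))) (fromℕ-cancel-≤ (proj₂ (x∩y d₀)))))))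

  Lbox⇒proper : ∀ {x y} → x ≢ y → Lbox b (h x y w) → Proper x × Proper y
  Lbox⇒proper x≢y (c₀ , c₁ , _) =
    trans (sym (proj₁ (count-h x≢y w))) c₀ , trans (sym (proj₂ (count-h x≢y w))) c₁

  occurrenceBoxes⇔ : ∀ {x y} → x ≢ y → (px : Proper x) (py : Proper y) →
                     Lbox b (h x y w) ⇔ BoxesIntersect (occurrenceBox x px) (occurrenceBox y py)
  occurrenceBoxes⇔ {x} {y} x≢y px py =
    Π-⇔ (λ d → KeptOccurrences.δ-h-good⇔overlap x≢y (toℕ d) w (enough px d) (enough py d))
    ⇔-∘ Lbox⇔ {s = h x y w} (trans (proj₁ (count-h x≢y w)) px , trans (proj₂ (count-h x≢y w)) py)
    where
    enough : ∀ {y} → Proper y → (d : Fin b) → suc (2 * toℕ d) < multiplicity y w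
    enough py d = subst (suc (2 * toℕ d) <_) (sym py) (odd<double (toℕ<n d))

  boxes⇔ : Fin b → ∀ {x y} → x ≢ y → Lbox b (h x y w) ⇔ BoxesIntersect (box x) (box y)
  boxes⇔ d₀ {x} {y} x≢y = by-properness (multiplicity x w ≟ 2 * b) (multiplicity y w ≟ 2 * b)
    where
    by-properness : ∀ px? py? → Lbox b (h x y w) ⇔ BoxesIntersect (boxOf x px?) (boxOf y py?)
    by-properness (yes px) (yes py) = occurrenceBoxes⇔ x≢y px py
    by-properness (no ¬px) py? =
      mk⇔ (⊥-elim ∘ ¬px ∘ proj₁ ∘ Lbox⇒proper x≢y) (⊥-elim ∘ improper-disjoint d₀ x≢y ¬px py?)
    by-properness (yes px) (no ¬py) =
      mk⇔ (⊥-elim ∘ ¬py ∘ proj₂ ∘ Lbox⇒proper x≢y)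
          (⊥-elim ∘ improper-disjoint d₀ (x≢y ∘ sym) ¬py (yes px)
                  ∘ BoxesIntersect-sym {B = occurrenceBox x px} {C = boxOf y (no ¬py)})

word⇒boxicity : ∀ {b} → b ≥ 1 → ∀ G → InClassG (Lbox b) G → BoxicityAtMost b G
word⇒boxicity b≥1 G (m , w , _ , f , adj⇔) =
  box ∘ to , λ u v u≢v → boxes⇔ (fromℕ< b≥1) (u≢v ∘ injective) ⇔-∘ adj⇔ u v u≢v
  where open WordBoxes w
        open Injection (↔⇒↣ f) using (to; injective)

-- (vertex, whether it is the upper end of the side)
Endpoint : ℕ → Set
Endpoint n = Fin n × Bool

module Sweep {n b : ℕ} (box : Fin n → Box b) (d : Fin b) where

  coordinate : Endpoint n → ℚ
  coordinate (x , false) = lo (box x) d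
  coordinate (x , true)  = hi (box x) d

  -- At equal coordinates lower ends come first, so closed sides that merely touch overlap.
  tiebreak : Endpoint n → ℕ
  tiebreak (x , false) = toℕ x
  tiebreak (x , true)  = n + toℕ x

  tiebreak-injective : ∀ {e e′} → tiebreak e ≡ tiebreak e′ → e ≡ e′
  tiebreak-injective {x , false} {y , false} eq = cong (_, false) (toℕ-injective eq)
  tiebreak-injective {x , true}  {y , true}  eq = cong (_, true) (toℕ-injective (+-cancelˡ-≡ n _ _ eq))
  tiebreak-injective {x , false} {y , true}  eq =
    contradiction (subst (_< n) eq (toℕ<n x)) (≤⇒≯ (m≤m+n n (toℕ y)))
  tiebreak-injective {x , true}  {y , false} eq =
    contradiction (subst (_< n) (sym eq) (toℕ<n y)) (≤⇒≯ (m≤m+n n (toℕ x)))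

  key : Endpoint n → ℚ × ℕ
  key e = coordinate e , tiebreak e

  endpointOrder : StrictTotalOrder 0ℓ 0ℓ 0ℓ
  endpointOrder = On.strictTotalOrder (×-strictTotalOrder ℚₚ.<-strictTotalOrder <-strictTotalOrder) key

  open StrictTotalOrder endpointOrder using (isStrictPartialOrder) renaming (_<_ to _⋖_)
  open StrictTotalOrderProperties endpointOrder using (decTotalOrder)
  open DecTotalOrder decTotalOrder using (totalOrder) renaming (_≤_ to _⊑_)
  open Sort decTotalOrder using (sort; sort-↭; sort-↗)
  open PermutationSetoidProperties (≡.setoid (Endpoint n)) using (Unique-resp-↭)

  endpoints : List (Endpoint n)
  endpoints = cartesianProduct (allFin n) (false ∷ true ∷ [])

  sweep : List (Endpoint n)
  sweep = sort endpoints

  ∈-sweep : ∀ e → e ∈ sweep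
  ∈-sweep (x , s) = ∈-resp-↭ (↭-sym (sort-↭ endpoints)) (∈-cartesianProduct⁺ (∈-allFin x) (∈-Bool s))
    where
    ∈-Bool : ∀ s → s ∈ false ∷ true ∷ []
    ∈-Bool false = ∈₁
    ∈-Bool true  = ∈₂

  sweep-unique : Unique sweep
  sweep-unique = Unique-resp-↭ (↭⇒↭ₛ (↭-sym (sort-↭ endpoints)))
                   (cartesianProduct⁺ (allFin⁺ n) (((λ ()) ∷ []) ∷ [] ∷ []))

  sweep-strictlySorted : AllPairs _⋖_ sweep
  sweep-strictlySorted =
    AllPairs.zipWith strict (Sorted⇒AllPairs totalOrder (sort-↗ endpoints) , sweep-unique)
    where
    strict : ∀ {e e′} → e ⊑ e′ × e ≢ e′ → e ⋖ e′
    strict (inj₁ e⋖e′ , _)              = e⋖e′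
    strict (inj₂ (_ , same-tiebreak) , e≢e′) = contradiction (tiebreak-injective same-tiebreak) e≢e′

  lower⋖upper : ∀ x → (x , false) ⋖ (x , true)
  lower⋖upper x with ℚₚ.<-cmp (lo (box x) d) (hi (box x) d)
  ... | tri< lo<hi _ _ = inj₁ lo<hi
  ... | tri≈ _ lo≡hi _ = inj₂ (lo≡hi , <-≤-trans (toℕ<n x) (m≤m+n n (toℕ x)))
  ... | tri> _ _ hi<lo = contradiction (ℚₚ.<-≤-trans hi<lo (lo≤hi (box x) d)) (ℚₚ.<-irrefl refl)

  upper⋪lower⇔ : ∀ x y → (¬ (x , true) ⋖ (y , false)) ⇔ lo (box y) d ℚ.≤ hi (box x) d
  upper⋪lower⇔ x y = mk⇔ (λ hi⋪lo → ℚₚ.≮⇒≥ (hi⋪lo ∘ inj₁)) λ where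
    lo≤hi (inj₁ hi<lo)       → ℚₚ.<-irrefl refl (ℚₚ.<-≤-trans hi<lo lo≤hi)
    _     (inj₂ (_ , n+x<y)) → ≤⇒≯ (≤-trans (<⇒≤ (toℕ<n y)) (m≤m+n n (toℕ x))) n+x<y

  block : List (Fin n)
  block = map proj₁ sweep

  module _ {u v : Fin n} (u≢v : u ≢ v) where

    private
      F : List (Endpoint n)
      F = filter (onUV? u v proj₁) sweep

      Q : List (Endpoint n)
      Q = (u , false) ∷ (u , true) ∷ (v , false) ∷ (v , true) ∷ []

      F⊆Q : F ⊆ Q
      F⊆Q {x , s} e∈F with proj₂ (∈-filter⁻ (onUV? u v proj₁) {xs = sweep} e∈F) | s
      ... | inj₁ refl | false = ∈₁
      ... | inj₁ refl | true  = ∈₂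
      ... | inj₂ refl | false = ∈₃
      ... | inj₂ refl | true  = ∈₄

      Q⊆F : Q ⊆ F
      Q⊆F = All.lookup {P = _∈ F}
        (on (inj₁ refl) ∷ on (inj₁ refl) ∷ on (inj₂ refl) ∷ on (inj₂ refl) ∷ [])
        where
        on : ∀ {x s} → x ≡ u ⊎ x ≡ v → (x , s) ∈ F
        on x∈uv = ∈-filter⁺ (onUV? u v proj₁) (∈-sweep _) x∈uv

      open StrictlySorted.Interleaving (≡-isStrictPartialOrder isStrictPartialOrder)
        (λ e → does (proj₁ e Fin.≟ v)) (dec-false (u Fin.≟ v) u≢v) (dec-false (u Fin.≟ v) u≢v)
        (dec-true (v Fin.≟ v) refl) (dec-true (v Fin.≟ v) refl)
        (lower⋖upper u) (lower⋖upper v)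
        (AllPairsₚ.filter⁺ (onUV? u v proj₁) sweep-strictlySorted) F⊆Q Q⊆F

    h-block-balanced : Balanced 2 (h u v block)
    h-block-balanced rewrite h-map u v u≢v proj₁ sweep = labels-balanced

    h-block-good⇔overlap :
      GoodPattern (h u v block) ⇔ (lo (box u) d ℚ.≤ hi (box v) d × lo (box v) d ℚ.≤ hi (box u) d)
    h-block-good⇔overlap rewrite h-map u v u≢v proj₁ sweep =
      (upper⋪lower⇔ v u ×-⇔ upper⋪lower⇔ u v) ⇔-∘ labels-good⇔overlap

module BoxWord {n b : ℕ} (box : Fin n → Box b) where

  open Sweep box using (block; ∈-sweep; h-block-balanced; h-block-good⇔overlap)

  word : List (Fin n)
  word = concat (tabulate block)

  letters-occur : Fin b → AllLettersOccur word
  letters-occur d₀ x = ∈-concat⁺′ (∈-map⁺ proj₁ (∈-sweep d₀ (x , false))) (∈-tabulate⁺ d₀)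

  word⇔ : ∀ {u v} → u ≢ v → Lbox b (h u v word) ⇔ BoxesIntersect (box u) (box v)
  word⇔ {u} {v} u≢v rewrite h-concat u v (tabulate block) | map-tabulate block (h u v) =
    Π-⇔ (λ d → subst (λ s → GoodPattern s ⇔ _) (sym (δ-concat _ balanced d))
                     (h-block-good⇔overlap d u≢v))
    ⇔-∘ Lbox⇔ {s = concat (tabulate (h u v ∘ block))} (Balanced-concat _ balanced)
    where
    balanced : ∀ d → Balanced 2 (h u v (block d))
    balanced d = h-block-balanced d u≢v

boxicity⇒word : ∀ {b} → b ≥ 1 → ∀ G → BoxicityAtMost b G → InClassG (Lbox b) G
boxicity⇒word b≥1 G (box , adj⇔) =
  n G , word , letters-occur (fromℕ< b≥1) , ↔-id _ , λ u v u≢v → ⇔-sym (word⇔ u≢v) ⇔-∘ adj⇔ u v u≢v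
  where open BoxWord box

Lbox-uniform : ∀ b → Uniform (2 * b) (Lbox b)
Lbox-uniform b _ (c₀ , c₁ , _) = c₀ , c₁

theorem4 : (b : ℕ) → b ≥ 1 →
    Uniform (2 * b) (Lbox b) × (∀ (G : Graph) → InClassG (Lbox b) G ⇔ BoxicityAtMost b G)
theorem4 b b≥1 = Lbox-uniform b , λ G → mk⇔ (word⇒boxicity b≥1 G) (boxicity⇒word b≥1 G)
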